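{- Let $m \ge 4$ be an integer and let $G = P_4 \mathbin{\Box} P_m$. Then $m(G,3) \ge \left\lfloor \frac{5(m+1)}{3} \right\rfloor + 1$.
   Context: For a graph $G$ and an integer $r \ge 2$, the $r$-neighbor bootstrap percolation process starting from a set $A_0 \subseteq V(G)$ of initially infected vertices is defined by $A_t = A_{t-1} \cup \{ v \in V(G) : |N_G(v) \cap A_{t-1}| \ge r\}$ for $t \ge 1$. The set $A_0$ is $r$-percolating if $\bigcup_{t \ge 0} A_t = V(G)$. The $r$-percolation number $m(G,r)$ is the minimum cardinality of an $r$-percolating set of $G$. $P_n$ denotes the path on $n$ vertices and $\mathbin{\Box}$ denotes the Cartesian product of graphs, so $P_n \mathbin{\Box} P_m$ is the $n \times m$ grid graph. -}

module Defs where

open import Data.Nat using (ℕ; zero; suc; _+_; _*_; _≤_; _≤ᵇ_; _/_)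
open import Data.Nat.Properties using (_≟_)
open import Data.Bool using (Bool; true; false; _∨_; _∧_; if_then_else_)
open import Data.Fin using (Fin; toℕ)
open import Data.Nat.ListAction using (sum)
open import Data.List using (List; map; allFin; cartesianProduct; length; filter)
open import Data.Product using (_×_; _,_; ∃)
open import Relation.Binary.PropositionalEquality using (_≡_)
open import Relation.Nullary.Decidable using (⌊_⌋)

record Graph : Set₁ where
  field
    V     : Set
    verts : List V          -- enumerates every vertex exactly once
    adj   : V → V → Bool

open Graph public

card : (G : Graph) → (V G → Bool) → ℕ
card G A = length (filter (λ v → A v Data.Bool.≟ true) (verts G))

nbrCount : (G : Graph) → (V G → Bool) → V G → ℕ
nbrCount G A v = sum (map (λ u → if adj G v u ∧ A u then 1 else 0) (verts G))

infected : (G : Graph) → ℕ → (V G → Bool) → ℕ → V G → Bool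
infected G r A₀ zero v = A₀ v
infected G r A₀ (suc t) v =
  infected G r A₀ t v ∨ (r ≤ᵇ nbrCount G (infected G r A₀ t) v)

Percolating : (G : Graph) → ℕ → (V G → Bool) → Set
Percolating G r A₀ = ∀ v → ∃ λ t → infected G r A₀ t v ≡ true

pathAdj : {n : ℕ} → Fin n → Fin n → Bool
pathAdj i j = ⌊ suc (toℕ i) ≟ toℕ j ⌋ ∨ ⌊ suc (toℕ j) ≟ toℕ i ⌋

eqFin : {n : ℕ} → Fin n → Fin n → Bool
eqFin i j = ⌊ toℕ i ≟ toℕ j ⌋

grid : ℕ → ℕ → Graph
grid n m = record
  { V     = Fin n × Fin m
  ; verts = cartesianProduct (allFin n) (allFin m)
  ; adj   = λ { (a , b) (c , d) →
              (eqFin a c ∧ pathAdj b d) ∨ (pathAdj a c ∧ eqFin b d) } }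

module Submission where

open import Defs
open import Data.Nat using (ℕ; zero; suc; pred; _+_; _*_; _≤_; _<_; _∸_; _⊔_; _/_; _≡ᵇ_; _≤ᵇ_; z≤n; s≤s)
open import Data.Nat.Properties
open import Data.Nat.DivMod using (m/n*n≤m)
open import Data.Nat.ListAction using (sum)
open import Data.Nat.ListAction.Properties using (sum-++)
open import Data.Nat.Tactic.RingSolver using (solve-∀)
open import Data.Bool using (Bool; true; false; _∨_; _∧_; not; if_then_else_; T)
open import Data.Bool.Properties using (T-∧; T-∨; ∧-zeroʳ; ∨-comm; ∧-comm)
open import Data.Bool.ListAction using (all)
open import Data.Fin using (Fin; toℕ)
open import Data.Fin.Properties using (toℕ<n)
open import Data.List using (List; []; _∷_; map; allFin; tabulate; cartesianProduct; filter; length; _++_)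
open import Data.List.Properties using (map-++; map-∘; map-tabulate)
open import Data.List.Relation.Unary.All as All using (All; []; _∷_)
open import Data.Vec using (Vec; []; _∷_)
open import Data.Product using (_×_; _,_; proj₁; proj₂; ∃)
open import Data.Sum using (inj₁; inj₂)
open import Data.Unit using (tt)
open import Function using (_∘_; id; Equivalence)
open import Relation.Binary.PropositionalEquality
open import Relation.Nullary.Decidable using (isYes≗does; dec-true; dec-false)

-- Give every vertex v a weight w v and every edge uv a cost c uv, and let the potential of an
-- infected set S be Φ(S) = 2·w(S) − Σ c uv, summed over ordered pairs of adjacent u, v ∈ S.
-- If a vertex with at least three infected neighbours never weighs more than the total cost
-- of its edges into S, then no round of 3-neighbour bootstrap percolation increases Φ.  On
-- P₄ □ Pₘ let edges at a corner cost 0, the middle edge of each end column cost 2 and all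
-- other edges 1, and let the four outer-row vertices next to an end column weigh 2 and all
-- other vertices 3.  Then Φ(V) ≥ 10m + 12, while Φ(A₀) ≤ 2·w(A₀) ≤ 6|A₀|.  Both local
-- inequalities depend only on where a vertex sits relative to the border of the grid, so
-- they are proved by evaluating them on every admissible local configuration.

⟦_⟧ : Bool → ℕ
⟦ b ⟧ = if b then 1 else 0

⟦⟧≤1 : ∀ b → ⟦ b ⟧ ≤ 1
⟦⟧≤1 true  = s≤s z≤n
⟦⟧≤1 false = z≤n

≤1⇒⟦⟧ : ∀ {x} → x ≤ 1 → ∃ λ b → x ≡ ⟦ b ⟧
≤1⇒⟦⟧ z≤n       = false , refl
≤1⇒⟦⟧ (s≤s z≤n) = true , refl

⟦⟧≡0 : ∀ {b} → ⟦ b ⟧ ≡ 0 → b ≡ false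
⟦⟧≡0 {false} _ = refl

⟦∧⟧ : ∀ a b → ⟦ a ∧ b ⟧ ≡ (if a then ⟦ b ⟧ else 0)
⟦∧⟧ true  b = refl
⟦∧⟧ false b = refl

⟦∧⟧≡* : ∀ a b → ⟦ a ∧ b ⟧ ≡ ⟦ a ⟧ * ⟦ b ⟧
⟦∧⟧≡* true  b = sym (+-identityʳ ⟦ b ⟧)
⟦∧⟧≡* false b = refl

*-if : ∀ x a y → x * (if a then y else 0) ≡ (if a then x * y else 0)
*-if x true  y = refl
*-if x false y = *-zeroʳ x

∑ : {A : Set} → List A → (A → ℕ) → ℕ
∑ xs f = sum (map f xs)

infix 2 ∑
syntax ∑ xs (λ x → e) = ∑[ x ∈ xs ] e

module _ {A : Set} where

  ∑-cong : ∀ xs {f g : A → ℕ} → (∀ x → f x ≡ g x) → ∑ xs f ≡ ∑ xs g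
  ∑-cong []       eq = refl
  ∑-cong (x ∷ xs) eq = cong₂ _+_ (eq x) (∑-cong xs eq)

  ∑-monoᴬ : ∀ {xs} {f g : A → ℕ} → All (λ x → f x ≤ g x) xs → ∑ xs f ≤ ∑ xs g
  ∑-monoᴬ []       = z≤n
  ∑-monoᴬ (p ∷ ps) = +-mono-≤ p (∑-monoᴬ ps)

  ∑-mono : ∀ xs {f g : A → ℕ} → (∀ x → f x ≤ g x) → ∑ xs f ≤ ∑ xs g
  ∑-mono []       le = z≤n
  ∑-mono (x ∷ xs) le = +-mono-≤ (le x) (∑-mono xs le)

  ∑-zero : ∀ xs {f : A → ℕ} → (∀ x → f x ≡ 0) → ∑ xs f ≡ 0
  ∑-zero []       eq = refl
  ∑-zero (x ∷ xs) eq = cong₂ _+_ (eq x) (∑-zero xs eq)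

  ∑-distrib-+ : ∀ xs (f g : A → ℕ) → (∑[ x ∈ xs ] f x + g x) ≡ ∑ xs f + ∑ xs g
  ∑-distrib-+ []       f g = refl
  ∑-distrib-+ (x ∷ xs) f g rewrite ∑-distrib-+ xs f g =
    +-assoc-comm (f x) (g x) (∑ xs f) (∑ xs g)
    where
    +-assoc-comm : ∀ a b c d → a + b + (c + d) ≡ a + c + (b + d)
    +-assoc-comm = solve-∀

  *-distribˡ-∑ : ∀ k xs (f : A → ℕ) → k * ∑ xs f ≡ (∑[ x ∈ xs ] k * f x)
  *-distribˡ-∑ k []       f = *-zeroʳ k
  *-distribˡ-∑ k (x ∷ xs) f =
    trans (*-distribˡ-+ k (f x) (∑ xs f)) (cong (k * f x +_) (*-distribˡ-∑ k xs f))

  *-distribʳ-∑ : ∀ k xs (f : A → ℕ) → ∑ xs f * k ≡ (∑[ x ∈ xs ] f x * k)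
  *-distribʳ-∑ k []       f = refl
  *-distribʳ-∑ k (x ∷ xs) f =
    trans (*-distribʳ-+ k (f x) (∑ xs f)) (cong (f x * k +_) (*-distribʳ-∑ k xs f))

module _ {A B : Set} where

  ∑-comm : ∀ xs ys (f : A → B → ℕ) →
    (∑[ x ∈ xs ] ∑[ y ∈ ys ] f x y) ≡ (∑[ y ∈ ys ] ∑[ x ∈ xs ] f x y)
  ∑-comm []       ys f = sym (∑-zero ys λ _ → refl)
  ∑-comm (x ∷ xs) ys f = begin
    ∑ ys (f x) + (∑[ x ∈ xs ] ∑[ y ∈ ys ] f x y) ≡⟨ cong (∑ ys (f x) +_) (∑-comm xs ys f) ⟩
    ∑ ys (f x) + (∑[ y ∈ ys ] ∑[ x ∈ xs ] f x y) ≡⟨ ∑-distrib-+ ys (f x) (λ y → ∑[ x ∈ xs ] f x y) ⟨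
    (∑[ y ∈ ys ] f x y + (∑[ x ∈ xs ] f x y))    ∎
    where open ≡-Reasoning

  ∑-cartesianProduct : ∀ xs ys (f : A × B → ℕ) →
    ∑ (cartesianProduct xs ys) f ≡ (∑[ x ∈ xs ] ∑[ y ∈ ys ] f (x , y))
  ∑-cartesianProduct []       ys f = refl
  ∑-cartesianProduct (x ∷ xs) ys f = begin
    sum (map f (map (x ,_) ys ++ cartesianProduct xs ys))
      ≡⟨ cong sum (map-++ f (map (x ,_) ys) (cartesianProduct xs ys)) ⟩
    sum (map f (map (x ,_) ys) ++ map f (cartesianProduct xs ys))
      ≡⟨ sum-++ (map f (map (x ,_) ys)) (map f (cartesianProduct xs ys)) ⟩
    sum (map f (map (x ,_) ys)) + ∑ (cartesianProduct xs ys) f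
      ≡⟨ cong₂ _+_ (cong sum (sym (map-∘ ys))) (∑-cartesianProduct xs ys f) ⟩
    (∑[ y ∈ ys ] f (x , y)) + (∑[ x ∈ xs ] ∑[ y ∈ ys ] f (x , y)) ∎
    where open ≡-Reasoning

  ∑-product : ∀ xs ys (f : A → ℕ) (g : B → ℕ) →
    (∑[ x ∈ xs ] ∑[ y ∈ ys ] f x * g y) ≡ ∑ xs f * ∑ ys g
  ∑-product xs ys f g = begin
    (∑[ x ∈ xs ] ∑[ y ∈ ys ] f x * g y) ≡⟨ ∑-cong xs (λ x → *-distribˡ-∑ (f x) ys g) ⟨
    (∑[ x ∈ xs ] f x * ∑ ys g)        ≡⟨ *-distribʳ-∑ (∑ ys g) xs f ⟨
    ∑ xs f * ∑ ys g                   ∎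
    where open ≡-Reasoning

card≡∑ : (G : Graph) (A : V G → Bool) → card G A ≡ (∑[ v ∈ verts G ] ⟦ A v ⟧)
card≡∑ G A = go (verts G)
  where
  go : ∀ vs → length (filter (λ v → A v Data.Bool.≟ true) vs) ≡ (∑[ v ∈ vs ] ⟦ A v ⟧)
  go []       = refl
  go (v ∷ vs) with A v
  ... | true  = cong suc (go vs)
  ... | false = go vs

∑< : ℕ → (ℕ → ℕ) → ℕ
∑< zero    f = 0
∑< (suc n) f = f 0 + ∑< n (f ∘ suc)

∑-allFin : ∀ n (f : ℕ → ℕ) → (∑[ a ∈ allFin n ] f (toℕ a)) ≡ ∑< n f
∑-allFin n f = trans (cong sum (map-tabulate {n = n} id (f ∘ toℕ))) (go n f)
  where
  go : ∀ n (f : ℕ → ℕ) → sum (tabulate {n = n} (f ∘ toℕ)) ≡ ∑< n f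
  go zero    f = refl
  go (suc n) f = cong (f 0 +_) (go n (f ∘ suc))

∑<-const : ∀ n c → ∑< n (λ _ → c) ≡ n * c
∑<-const zero    c = refl
∑<-const (suc n) c = cong (c +_) (∑<-const n c)

∑<-zero : ∀ n → ∑< n (λ _ → 0) ≡ 0
∑<-zero n = trans (∑<-const n 0) (*-zeroʳ n)

∑<-snoc : ∀ n f → ∑< (suc n) f ≡ ∑< n f + f n
∑<-snoc zero    f = +-comm (f 0) 0
∑<-snoc (suc n) f = trans (cong (f 0 +_) (∑<-snoc n (f ∘ suc))) (sym (+-assoc (f 0) _ _))

∑<-cong : ∀ n {f g} → (∀ j → j < n → f j ≡ g j) → ∑< n f ≡ ∑< n g
∑<-cong zero    eq = refl
∑<-cong (suc n) eq = cong₂ _+_ (eq 0 (s≤s z≤n)) (∑<-cong n λ j j<n → eq (suc j) (s≤s j<n))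

≡ᵇ-comm : ∀ x y → (x ≡ᵇ y) ≡ (y ≡ᵇ x)
≡ᵇ-comm zero    zero    = refl
≡ᵇ-comm zero    (suc y) = refl
≡ᵇ-comm (suc x) zero    = refl
≡ᵇ-comm (suc x) (suc y) = ≡ᵇ-comm x y

count-≡ᵇ : ∀ n k → ∑< n (λ y → ⟦ k ≡ᵇ y ⟧) ≤ 1
count-≡ᵇ zero    k       = z≤n
count-≡ᵇ (suc n) zero    = s≤s (≤-reflexive (∑<-zero n))
count-≡ᵇ (suc n) (suc k) = count-≡ᵇ n k

count-suc-≡ᵇ : ∀ n k → ∑< n (λ y → ⟦ suc y ≡ᵇ k ⟧) ≤ 1
count-suc-≡ᵇ zero    k             = z≤n
count-suc-≡ᵇ (suc n) zero          = ≤-trans (≤-reflexive (∑<-zero n)) z≤n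
count-suc-≡ᵇ (suc n) (suc zero)    = s≤s (≤-reflexive (∑<-zero n))
count-suc-≡ᵇ (suc n) (suc (suc k)) = count-suc-≡ᵇ n (suc k)

-- Weighted potentials for bootstrap percolation

telescope : (a b : ℕ → ℕ) → (∀ t → a (suc t) + b t ≤ a t + b (suc t)) →
  ∀ t → a t + b 0 ≤ a 0 + b t
telescope a b step zero    = ≤-refl
telescope a b step (suc t) = +-cancelʳ-≤ (a t + b t) _ _ (begin
  a (suc t) + b 0 + (a t + b t)   ≡⟨ rearrange (a (suc t)) (b 0) (a t) (b t) ⟩
  a (suc t) + b t + (a t + b 0)   ≤⟨ +-mono-≤ (step t) (telescope a b step t) ⟩
  a t + b (suc t) + (a 0 + b t)   ≡⟨ rearrange′ (a t) (b (suc t)) (a 0) (b t) ⟩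
  a 0 + b (suc t) + (a t + b t)   ∎)
  where
  open ≤-Reasoning
  rearrange : ∀ w x y z → w + x + (y + z) ≡ w + z + (y + x)
  rearrange = solve-∀
  rearrange′ : ∀ w x y z → w + x + (y + z) ≡ y + x + (w + z)
  rearrange′ = solve-∀

infected-mono : ∀ G r A {t t′} v → t ≤ t′ → infected G r A t v ≡ true → infected G r A t′ v ≡ true
infected-mono G r A {t} {t′} v t≤t′ h =
  subst (λ s → infected G r A s v ≡ true) (m∸n+n≡m t≤t′) (later (t′ ∸ t))
  where
  later : ∀ s → infected G r A (s + t) v ≡ true
  later zero    = h
  later (suc s) rewrite later s = refl

eventually-all : ∀ G r A → Percolating G r A → (vs : List (V G)) →
  ∃ λ t → All (λ v → infected G r A t v ≡ true) vs
eventually-all G r A perc []       = 0 , []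
eventually-all G r A perc (v ∷ vs) with perc v | eventually-all G r A perc vs
... | t , h | t′ , hs =
  t ⊔ t′ , infected-mono G r A v (m≤m⊔n t t′) h ∷ All.map (infected-mono G r A _ (m≤n⊔m t t′)) hs

module Potential (G : Graph) (r : ℕ) (w : V G → ℕ) (c : V G → V G → ℕ)
  (c-sym : ∀ u v → c u v ≡ c v u)
  (w≤c : ∀ S v → r ≤ nbrCount G S v → w v ≤ (∑[ u ∈ verts G ] ⟦ S u ⟧ * c v u))
  where

  Vs : List (V G)
  Vs = verts G

  weight : (V G → ℕ) → ℕ
  weight f = ∑[ v ∈ Vs ] f v * w v

  energy : (V G → ℕ) → (V G → ℕ) → ℕ
  energy f g = ∑[ v ∈ Vs ] ∑[ u ∈ Vs ] f v * (g u * c v u)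

  weight-+ : ∀ f g → weight (λ v → f v + g v) ≡ weight f + weight g
  weight-+ f g = trans (∑-cong Vs λ v → *-distribʳ-+ (w v) (f v) (g v))
                       (∑-distrib-+ Vs (λ v → f v * w v) (λ v → g v * w v))

  energy-+ˡ : ∀ f f′ g → energy (λ v → f v + f′ v) g ≡ energy f g + energy f′ g
  energy-+ˡ f f′ g = trans (∑-cong Vs λ v → trans (∑-cong Vs λ u → *-distribʳ-+ _ (f v) (f′ v))
                                                  (∑-distrib-+ Vs _ _))
                           (∑-distrib-+ Vs _ _)

  energy-+ʳ : ∀ f g g′ → energy f (λ u → g u + g′ u) ≡ energy f g + energy f g′
  energy-+ʳ f g g′ = trans (∑-cong Vs λ v → trans (∑-cong Vs λ u → distrib (f v) (g u) (g′ u) (c v u))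
                                                  (∑-distrib-+ Vs _ _))
                           (∑-distrib-+ Vs _ _)
    where
    distrib : ∀ x y z k → x * ((y + z) * k) ≡ x * (y * k) + x * (z * k)
    distrib = solve-∀

  weight-cong : ∀ {f f′} → (∀ v → f v ≡ f′ v) → weight f ≡ weight f′
  weight-cong eq = ∑-cong Vs λ v → cong (_* w v) (eq v)

  energy-cong : ∀ {f f′ g g′} → (∀ v → f v ≡ f′ v) → (∀ u → g u ≡ g′ u) →
    energy f g ≡ energy f′ g′
  energy-cong eqf eqg = ∑-cong Vs λ v → ∑-cong Vs λ u →
    cong₂ (λ x y → x * (y * c v u)) (eqf v) (eqg u)

  energy-comm : ∀ f g → energy f g ≡ energy g f
  energy-comm f g = trans (∑-comm Vs Vs _) (∑-cong Vs λ u → ∑-cong Vs λ v →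
    trans (cong (λ k → f v * (g u * k)) (c-sym v u)) (swap (f v) (g u) (c u v)))
    where
    swap : ∀ x y k → x * (y * k) ≡ y * (x * k)
    swap = solve-∀

  -- One round of infection does not increase the potential 2·weight − energy.
  module Step (S : V G → Bool) where

    new : V G → Bool
    new v = not (S v) ∧ (r ≤ᵇ nbrCount G S v)

    S′ : V G → Bool
    S′ v = S v ∨ (r ≤ᵇ nbrCount G S v)

    ⟦S′⟧ : ∀ v → ⟦ S′ v ⟧ ≡ ⟦ S v ⟧ + ⟦ new v ⟧
    ⟦S′⟧ v with S v | r ≤ᵇ nbrCount G S v
    ... | true  | _     = refl
    ... | false | true  = refl
    ... | false | false = refl

    s s′ δ : V G → ℕ
    s  v = ⟦ S v ⟧
    s′ v = ⟦ S′ v ⟧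
    δ  v = ⟦ new v ⟧

    weight-new≤energy : weight δ ≤ energy δ s
    weight-new≤energy = ≤-trans (∑-mono Vs pointwise)
      (≤-reflexive (∑-cong Vs λ v → *-distribˡ-∑ (δ v) Vs (λ u → s u * c v u)))
      where
      pointwise : ∀ v → δ v * w v ≤ δ v * (∑[ u ∈ Vs ] s u * c v u)
      pointwise v with S v | r ≤ᵇ nbrCount G S v in eq
      ... | true  | _     = z≤n
      ... | false | false = z≤n
      ... | false | true  = *-monoʳ-≤ 1 (w≤c S v (≤ᵇ⇒≤ r _ (subst T (sym eq) _)))

    energy-grows : energy s s + 2 * energy δ s ≤ energy s′ s′
    energy-grows = begin
      energy s s + 2 * energy δ s
        ≡⟨ cong (λ x → energy s s + (energy δ s + x)) (+-identityʳ _) ⟩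
      energy s s + (energy δ s + energy δ s)
        ≡⟨ cong (λ x → energy s s + (x + energy δ s)) (energy-comm δ s) ⟩
      energy s s + (energy s δ + energy δ s)
        ≤⟨ ≤-trans (m≤m+n _ (energy δ δ))
                   (≤-reflexive (regroup (energy s s) (energy s δ) (energy δ s) (energy δ δ))) ⟩
      (energy s s + energy s δ) + (energy δ s + energy δ δ)
        ≡⟨ cong₂ _+_ (energy-+ʳ s s δ) (energy-+ʳ δ s δ) ⟨
      energy s s+δ + energy δ s+δ
        ≡⟨ energy-+ˡ s δ s+δ ⟨
      energy s+δ s+δ
        ≡⟨ energy-cong (λ v → sym (⟦S′⟧ v)) (λ u → sym (⟦S′⟧ u)) ⟩
      energy s′ s′ ∎
      where
      open ≤-Reasoning
      s+δ : V G → ℕ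
      s+δ v = s v + δ v
      regroup : ∀ a b c d → a + (b + c) + d ≡ a + b + (c + d)
      regroup = solve-∀

    potential-step : 2 * weight s′ + energy s s ≤ 2 * weight s + energy s′ s′
    potential-step = begin
      2 * weight s′ + energy s s
        ≡⟨ cong (λ x → 2 * x + energy s s)
                (trans (weight-cong ⟦S′⟧) (weight-+ s δ)) ⟩
      2 * (weight s + weight δ) + energy s s
        ≤⟨ +-monoˡ-≤ (energy s s) (*-monoʳ-≤ 2 (+-monoʳ-≤ (weight s) weight-new≤energy)) ⟩
      2 * (weight s + energy δ s) + energy s s
        ≡⟨ regroup (weight s) (energy δ s) (energy s s) ⟩
      2 * weight s + (energy s s + 2 * energy δ s)
        ≤⟨ +-monoʳ-≤ (2 * weight s) energy-grows ⟩
      2 * weight s + energy s′ s′ ∎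
      where
      open ≤-Reasoning
      regroup : ∀ a b c → 2 * (a + b) + c ≡ 2 * a + (c + 2 * b)
      regroup = solve-∀

  excess-bound : (ρ : V G → ℕ) → (∀ v → ρ v + (∑[ u ∈ Vs ] c v u) ≤ 2 * w v) →
    ∀ A → Percolating G r A → ∑ Vs ρ ≤ 2 * weight (λ v → ⟦ A v ⟧)
  excess-bound ρ ρ+c≤2w A percolates with eventually-all G r A percolates Vs
  ... | τ , full = +-cancelʳ-≤ (energy one one) _ _ (begin
    ∑ Vs ρ + energy one one                ≤⟨ excess-total ⟩
    2 * weight one                         ≤⟨ *-monoʳ-≤ 2 (∑-monoᴬ (All.map weight-full full)) ⟩
    2 * weight (s τ)                       ≤⟨ m≤m+n _ _ ⟩
    2 * weight (s τ) + energy (s 0) (s 0)  ≤⟨ telescope (λ t → 2 * weight (s t)) (λ t → energy (s t) (s t))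
                                                        (λ t → Step.potential-step (infected G r A t)) τ ⟩
    2 * weight (s 0) + energy (s τ) (s τ)  ≤⟨ +-monoʳ-≤ _ (∑-mono Vs λ v → ∑-mono Vs λ u →
                                                 *-mono-≤ (⟦⟧≤1 (infected G r A τ v))
                                                          (*-monoˡ-≤ (c v u) (⟦⟧≤1 (infected G r A τ u)))) ⟩
    2 * weight (s 0) + energy one one      ∎)
    where
    open ≤-Reasoning
    s : ℕ → V G → ℕ
    s t v = ⟦ infected G r A t v ⟧
    one : V G → ℕ
    one _ = 1
    weight-full : ∀ {v} → infected G r A τ v ≡ true → 1 * w v ≤ s τ v * w v
    weight-full eq rewrite eq = ≤-refl
    excess-total : ∑ Vs ρ + energy one one ≤ 2 * weight one
    excess-total = begin
      ∑ Vs ρ + energy one one                          ≡⟨ ∑-distrib-+ Vs ρ _ ⟨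
      (∑[ v ∈ Vs ] ρ v + (∑[ u ∈ Vs ] 1 * (1 * c v u))) ≤⟨ ∑-mono Vs (λ v → subst₂ _≤_
          (cong (ρ v +_) (∑-cong Vs λ u → sym (trans (*-identityˡ _) (*-identityˡ _))))
          (cong (2 *_) (sym (*-identityˡ (w v)))) (ρ+c≤2w v)) ⟩
      (∑[ v ∈ Vs ] 2 * (1 * w v))                      ≡⟨ *-distribˡ-∑ 2 Vs _ ⟨
      2 * weight one                                   ∎

data Move : Set where
  stay forward backward : Move

steps : Move → ℕ → ℕ → Bool
steps stay     x y = x ≡ᵇ y
steps forward  x y = suc x ≡ᵇ y
steps backward x y = suc y ≡ᵇ x

move : Move → ℕ → ℕ
move stay     x = x
move forward  x = suc x
move backward x = pred x

steps⇒move : ∀ μ x y → T (steps μ x y) → y ≡ move μ x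
steps⇒move stay     x y h = sym (≡ᵇ⇒≡ x y h)
steps⇒move forward  x y h = sym (≡ᵇ⇒≡ (suc x) y h)
steps⇒move backward x y h = cong pred (≡ᵇ⇒≡ (suc y) x h)

stay-forward : ∀ x y → (steps stay x y ∧ steps forward x y) ≡ false
stay-forward zero    zero    = refl
stay-forward zero    (suc y) = refl
stay-forward (suc x) zero    = refl
stay-forward (suc x) (suc y) = stay-forward x y

stay-backward : ∀ x y → (steps stay x y ∧ steps backward x y) ≡ false
stay-backward zero    zero    = refl
stay-backward zero    (suc y) = refl
stay-backward (suc x) zero    = refl
stay-backward (suc x) (suc y) = stay-backward x y

forward-backward : ∀ x y → (steps forward x y ∧ steps backward x y) ≡ false
forward-backward zero    zero          = refl
forward-backward zero    (suc zero)    = refl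
forward-backward zero    (suc (suc y)) = refl
forward-backward (suc x) zero          = refl
forward-backward (suc x) (suc y)       = forward-backward x y

count-steps : ∀ μ n x → (∑[ a ∈ allFin n ] ⟦ steps μ x (toℕ a) ⟧) ≤ 1
count-steps stay     n x = subst (_≤ 1) (sym (∑-allFin n _)) (count-≡ᵇ n x)
count-steps forward  n x = subst (_≤ 1) (sym (∑-allFin n _)) (count-≡ᵇ n (suc x))
count-steps backward n x = subst (_≤ 1) (sym (∑-allFin n _)) (count-suc-≡ᵇ n x)

isEnd : ℕ → ℕ → Bool
isEnd n x = (x ≡ᵇ 0) ∨ (suc x ≡ᵇ n)

-- What the weights can see of a coordinate x on the path 0, 1, …, n − 1.  Since pred 0 = 0,
-- prevIsEnd is meaningless (always true) at x = 0.
record AxisView : Set where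
  constructor axis
  field
    isFirst isLast prevIsEnd nextIsEnd : Bool

axisView : ℕ → ℕ → AxisView
axisView n x = axis (x ≡ᵇ 0) (suc x ≡ᵇ n) (isEnd n (pred x)) (isEnd n (suc x))

isEndᵛ : AxisView → Bool
isEndᵛ a = AxisView.isFirst a ∨ AxisView.isLast a

leaves : Move → AxisView → Bool
leaves stay     _ = false
leaves forward  a = AxisView.isLast a
leaves backward a = AxisView.isFirst a

steps-leaves : ∀ μ {n} x (y : Fin n) → T (leaves μ (axisView n x)) → steps μ x (toℕ y) ≡ false
steps-leaves forward {n} x y h =
  dec-false (suc x ≟ toℕ y) λ e → <-irrefl (trans (sym e) (≡ᵇ⇒≡ (suc x) n h)) (toℕ<n y)
steps-leaves backward zero y h = refl

endAfter : Move → AxisView → Bool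
endAfter stay     a = isEndᵛ a
endAfter forward  a = AxisView.nextIsEnd a
endAfter backward a = AxisView.prevIsEnd a

isEnd-move : ∀ μ n x → isEnd n (move μ x) ≡ endAfter μ (axisView n x)
isEnd-move stay     n x = refl
isEnd-move forward  n x = refl
isEnd-move backward n x = refl

axisOK : AxisView → Bool
axisOK (axis first last prevEnd nextEnd) =
  (first ∧ not last ∧ not nextEnd) ∨ (last ∧ not first ∧ not prevEnd) ∨
  (not first ∧ not last ∧ not (prevEnd ∧ nextEnd))

axisView-ok : ∀ {n} → 4 ≤ n → ∀ {x} → x < n → T (axisOK (axisView n x))
axisView-ok (s≤s (s≤s (s≤s (s≤s _)))) {zero}        _ = tt
axisView-ok (s≤s (s≤s (s≤s (s≤s _)))) {suc zero}    _ = tt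
axisView-ok {suc (suc (suc (suc k)))} (s≤s (s≤s (s≤s (s≤s _)))) {suc (suc z)} (s≤s (s≤s (s≤s z<)))
  rewrite dec-false (z ≟ suc (suc k)) (<⇒≢ (s≤s z<)) with z ≡ᵇ suc k
... | true  = tt
... | false = tt

rowOK : AxisView → Bool
rowOK a = axisOK a ∧ (isEndᵛ a ∨ AxisView.prevIsEnd a ∨ AxisView.nextIsEnd a)

rowView-ok : ∀ {x} → x < 4 → T (rowOK (axisView 4 x))
rowView-ok {0} _ = tt
rowView-ok {1} _ = tt
rowView-ok {2} _ = tt
rowView-ok {3} _ = tt
rowView-ok {suc (suc (suc (suc _)))} (s≤s (s≤s (s≤s (s≤s ()))))

data Direction : Set where
  right left down up : Direction

directions : List Direction
directions = right ∷ left ∷ down ∷ up ∷ []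

rowMove colMove : Direction → Move
rowMove right = stay
rowMove left  = stay
rowMove down  = forward
rowMove up    = backward
colMove right = forward
colMove left  = backward
colMove down  = stay
colMove up    = stay

Pos : Set
Pos = ℕ × ℕ

isStep : Direction → Pos → Pos → Bool
isStep d (i , j) (i′ , j′) = steps (rowMove d) i i′ ∧ steps (colMove d) j j′

neighbour : Direction → Pos → Pos
neighbour d (i , j) = move (rowMove d) i , move (colMove d) j

isStep⇒neighbour : ∀ d p q → T (isStep d p q) → q ≡ neighbour d p
isStep⇒neighbour d (i , j) (i′ , j′) h with Equivalence.to T-∧ h
... | hi , hj = cong₂ _,_ (steps⇒move (rowMove d) i i′ hi) (steps⇒move (colMove d) j j′ hj)

adjacentᵇ : Pos → Pos → Bool
adjacentᵇ (i , j) (i′ , j′) =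
  (steps stay i i′ ∧ (steps forward j j′ ∨ steps backward j j′)) ∨
  ((steps forward i i′ ∨ steps backward i i′) ∧ steps stay j j′)

-- Swapping the endpoints exchanges forward and backward steps.
adjacentᵇ-comm : ∀ p q → adjacentᵇ p q ≡ adjacentᵇ q p
adjacentᵇ-comm (i , j) (i′ , j′) =
  cong₂ _∨_ (cong₂ _∧_ (≡ᵇ-comm i i′) (∨-comm (suc j ≡ᵇ j′) (suc j′ ≡ᵇ j)))
            (cong₂ _∧_ (∨-comm (suc i ≡ᵇ i′) (suc i′ ≡ᵇ i)) (≡ᵇ-comm j j′))

private
  if-split : ∀ a b c d e f x → (b ∧ c) ≡ false → (d ∧ e) ≡ false → (a ∧ d) ≡ false → (a ∧ e) ≡ false →
    (if (a ∧ (b ∨ c)) ∨ ((d ∨ e) ∧ f) then x else 0) ≡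
    (if a ∧ b then x else 0) + ((if a ∧ c then x else 0) +
      ((if d ∧ f then x else 0) + ((if e ∧ f then x else 0) + 0)))
  if-split true  true  true  _     _     _     x () _  _  _
  if-split true  _     _     true  _     _     x _  _  () _
  if-split true  _     _     false true  _     x _  _  _  ()
  if-split true  true  false false false _     x _  _  _  _ = sym (+-identityʳ x)
  if-split true  false true  false false _     x _  _  _  _ = sym (+-identityʳ x)
  if-split true  false false false false _     x _  _  _  _ = refl
  if-split false _     _     true  true  _     x _  () _  _
  if-split false _     _     true  false true  x _  _  _  _ = sym (+-identityʳ x)
  if-split false _     _     false true  true  x _  _  _  _ = sym (+-identityʳ x)
  if-split false _     _     true  false false x _  _  _  _ = refl
  if-split false _     _     false true  false x _  _  _  _ = refl
  if-split false _     _     false false _     x _  _  _  _ = refl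

if-adjacent : ∀ p q x →
  (if adjacentᵇ p q then x else 0) ≡ (∑[ d ∈ directions ] (if isStep d p q then x else 0))
if-adjacent (i , j) (i′ , j′) x =
  if-split (steps stay i i′) (steps forward j j′) (steps backward j j′)
           (steps forward i i′) (steps backward i i′) (steps stay j j′) x
           (forward-backward j j′) (forward-backward i i′) (stay-forward i i′) (stay-backward i i′)

blocked : ℕ → ℕ → Direction → Pos → Bool
blocked n m d (i , j) = leaves (rowMove d) (axisView n i) ∨ leaves (colMove d) (axisView m j)

module _ {n m : ℕ} where

  pos : Fin n × Fin m → Pos
  pos (a , b) = toℕ a , toℕ b

  adj-grid : ∀ v u → adj (grid n m) v u ≡ adjacentᵇ (pos v) (pos u)
  adj-grid (a , b) (c , d)
    rewrite isYes≗does (toℕ a ≟ toℕ c) | isYes≗does (toℕ b ≟ toℕ d)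
          | isYes≗does (suc (toℕ b) ≟ toℕ d) | isYes≗does (suc (toℕ d) ≟ toℕ b)
          | isYes≗does (suc (toℕ a) ≟ toℕ c) | isYes≗does (suc (toℕ c) ≟ toℕ a) = refl

  stepSum : Direction → Fin n × Fin m → (Fin n × Fin m → ℕ) → ℕ
  stepSum d v f = ∑[ u ∈ verts (grid n m) ] (if isStep d (pos v) (pos u) then f u else 0)

  ∑-adjacent : ∀ v f → (∑[ u ∈ verts (grid n m) ] (if adj (grid n m) v u then f u else 0))
                     ≡ (∑[ d ∈ directions ] stepSum d v f)
  ∑-adjacent v f =
    trans (∑-cong (verts (grid n m)) λ u →
             trans (cong (λ b → if b then f u else 0) (adj-grid v u)) (if-adjacent (pos v) (pos u) (f u)))
          (∑-comm (verts (grid n m)) directions λ u d → if isStep d (pos v) (pos u) then f u else 0)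

  nbrCount≡∑stepSum : ∀ S v → nbrCount (grid n m) S v ≡ (∑[ d ∈ directions ] stepSum d v (⟦_⟧ ∘ S))
  nbrCount≡∑stepSum S v =
    trans (∑-cong (verts (grid n m)) λ u → ⟦∧⟧ (adj (grid n m) v u) (S u)) (∑-adjacent v (⟦_⟧ ∘ S))

  stepSum-weighted : ∀ d v f (g : Pos → ℕ) →
    stepSum d v (λ u → f u * g (pos u)) ≡ stepSum d v f * g (neighbour d (pos v))
  stepSum-weighted d v f g =
    trans (∑-cong (verts (grid n m)) pointwise) (sym (*-distribʳ-∑ _ (verts (grid n m)) _))
    where
    pointwise : ∀ u → (if isStep d (pos v) (pos u) then f u * g (pos u) else 0)
                    ≡ (if isStep d (pos v) (pos u) then f u else 0) * g (neighbour d (pos v))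
    pointwise u with isStep d (pos v) (pos u) in eq
    ... | true  = cong (λ q → f u * g q) (isStep⇒neighbour d (pos v) (pos u) (subst T (sym eq) _))
    ... | false = refl

  stepSum-≤1 : ∀ d v S → stepSum d v (⟦_⟧ ∘ S) ≤ 1
  stepSum-≤1 d (a , b) S = begin
    stepSum d (a , b) (⟦_⟧ ∘ S)
      ≤⟨ ∑-mono (verts (grid n m)) (λ u → if≤⟦⟧ (isStep d (pos (a , b)) (pos u)) (S u)) ⟩
    (∑[ u ∈ verts (grid n m) ] ⟦ isStep d (pos (a , b)) (pos u) ⟧)
      ≡⟨ ∑-cartesianProduct (allFin n) (allFin m) _ ⟩
    (∑[ a′ ∈ allFin n ] ∑[ b′ ∈ allFin m ] ⟦ rowStep a′ ∧ colStep b′ ⟧)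
      ≡⟨ ∑-cong (allFin n) (λ a′ → ∑-cong (allFin m) λ b′ → ⟦∧⟧≡* (rowStep a′) (colStep b′)) ⟩
    (∑[ a′ ∈ allFin n ] ∑[ b′ ∈ allFin m ] ⟦ rowStep a′ ⟧ * ⟦ colStep b′ ⟧)
      ≡⟨ ∑-product (allFin n) (allFin m) (⟦_⟧ ∘ rowStep) (⟦_⟧ ∘ colStep) ⟩
    (∑[ a′ ∈ allFin n ] ⟦ rowStep a′ ⟧) * (∑[ b′ ∈ allFin m ] ⟦ colStep b′ ⟧)
      ≤⟨ *-mono-≤ (count-steps (rowMove d) n (toℕ a)) (count-steps (colMove d) m (toℕ b)) ⟩
    1 ∎
    where
    open ≤-Reasoning
    rowStep : Fin n → Bool
    rowStep a′ = steps (rowMove d) (toℕ a) (toℕ a′)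
    colStep : Fin m → Bool
    colStep b′ = steps (colMove d) (toℕ b) (toℕ b′)
    if≤⟦⟧ : ∀ p s → (if p then ⟦ s ⟧ else 0) ≤ ⟦ p ⟧
    if≤⟦⟧ true  s = ⟦⟧≤1 s
    if≤⟦⟧ false s = z≤n

  stepSum-blocked : ∀ d v f → T (blocked n m d (pos v)) → stepSum d v f ≡ 0
  stepSum-blocked d (a , b) f h = ∑-zero (verts (grid n m)) summand
    where
    summand : ∀ u → (if isStep d (pos (a , b)) (pos u) then f u else 0) ≡ 0
    summand (a′ , b′) with Equivalence.to T-∨ h
    ... | inj₁ hr rewrite steps-leaves (rowMove d) (toℕ a) a′ hr = refl
    ... | inj₂ hc rewrite steps-leaves (colMove d) (toℕ b) b′ hc
                        | ∧-zeroʳ (steps (rowMove d) (toℕ a) (toℕ a′)) = refl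

-- Weights on P₄ □ Pₘ

edgeWeightᵇ : (t e t′ e′ : Bool) → ℕ
edgeWeightᵇ t e t′ e′ = if (t ∧ e) ∨ (t′ ∧ e′) then 0 else if e ∧ e′ then 2 else 1

edgeWeight : ℕ → Pos → Pos → ℕ
edgeWeight m (i , j) (i′ , j′) = edgeWeightᵇ (isEnd 4 i) (isEnd m j) (isEnd 4 i′) (isEnd m j′)

edgeWeight-comm : ∀ m p q → edgeWeight m p q ≡ edgeWeight m q p
edgeWeight-comm m (i , j) (i′ , j′) =
  cong₂ (λ a b → if a then 0 else if b then 2 else 1)
        (∨-comm (isEnd 4 i ∧ isEnd m j) (isEnd 4 i′ ∧ isEnd m j′)) (∧-comm (isEnd m j) (isEnd m j′))

costᵛ : Direction → AxisView → AxisView → ℕ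
costᵛ d R C = edgeWeightᵇ (isEndᵛ R) (isEndᵛ C) (endAfter (rowMove d) R) (endAfter (colMove d) C)

vertexWeightᵛ : AxisView → AxisView → ℕ
vertexWeightᵛ R C =
  if isEndᵛ R ∧ not (isEndᵛ C) ∧ (AxisView.prevIsEnd C ∨ AxisView.nextIsEnd C) then 2 else 3

excessᵛ : AxisView → AxisView → ℕ
excessᵛ R C =
  if isEndᵛ C then (if isEndᵛ R then 6 else 3)
  else if AxisView.prevIsEnd C ∨ AxisView.nextIsEnd C then 2
  else if isEndᵛ R then 3 else 2

module _ {m : ℕ} where

  rowView colView : Fin 4 × Fin m → AxisView
  rowView (a , b) = axisView 4 (toℕ a)
  colView (a , b) = axisView m (toℕ b)

  edgeCost : Fin 4 × Fin m → Fin 4 × Fin m → ℕ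
  edgeCost v u = if adj (grid 4 m) v u then edgeWeight m (pos v) (pos u) else 0

  vertexWeight excess : Fin 4 × Fin m → ℕ
  vertexWeight v = vertexWeightᵛ (rowView v) (colView v)
  excess       v = excessᵛ (rowView v) (colView v)

  edgeWeight-neighbour : ∀ d v →
    edgeWeight m (pos v) (neighbour d (pos v)) ≡ costᵛ d (rowView v) (colView v)
  edgeWeight-neighbour d (a , b) =
    cong₂ (edgeWeightᵇ (isEnd 4 (toℕ a)) (isEnd m (toℕ b)))
          (isEnd-move (rowMove d) 4 (toℕ a)) (isEnd-move (colMove d) m (toℕ b))

edgeCost-comm : ∀ {m} (v u : Fin 4 × Fin m) → edgeCost v u ≡ edgeCost u v
edgeCost-comm {m} v u =
  cong₂ (λ a w → if a then w else 0)
        (trans (adj-grid v u) (trans (adjacentᵇ-comm (pos v) (pos u)) (sym (adj-grid u v))))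
        (edgeWeight-comm m (pos v) (pos u))

vertexWeight≤3 : ∀ {m} (v : Fin 4 × Fin m) → vertexWeight v ≤ 3
vertexWeight≤3 v = if-≤ (isEndᵛ (rowView v) ∧ not (isEndᵛ (colView v))
                          ∧ (AxisView.prevIsEnd (colView v) ∨ AxisView.nextIsEnd (colView v)))
  where
  if-≤ : ∀ b → (if b then 2 else 3) ≤ 3
  if-≤ true  = s≤s (s≤s z≤n)
  if-≤ false = ≤-refl

weight≤3*card : ∀ {m} (A : Fin 4 × Fin m → Bool) →
  (∑[ v ∈ verts (grid 4 m) ] ⟦ A v ⟧ * vertexWeight v) ≤ 3 * card (grid 4 m) A
weight≤3*card {m} A = begin
  (∑[ v ∈ verts (grid 4 m) ] ⟦ A v ⟧ * vertexWeight v)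
    ≤⟨ ∑-mono (verts (grid 4 m)) (λ v → *-monoʳ-≤ ⟦ A v ⟧ (vertexWeight≤3 v)) ⟩
  (∑[ v ∈ verts (grid 4 m) ] ⟦ A v ⟧ * 3)  ≡⟨ *-distribʳ-∑ 3 (verts (grid 4 m)) (⟦_⟧ ∘ A) ⟨
  (∑[ v ∈ verts (grid 4 m) ] ⟦ A v ⟧) * 3 ≡⟨ cong (_* 3) (card≡∑ (grid 4 m) A) ⟨
  card (grid 4 m) A * 3                     ≡⟨ *-comm (card (grid 4 m) A) 3 ⟩
  3 * card (grid 4 m) A                     ∎
  where open ≤-Reasoning

-- Exhaustive local checks

_⇒_ : Bool → Bool → Bool
a ⇒ b = not a ∨ b

modus-ponens : ∀ {a b} → T (a ⇒ b) → T a → T b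
modus-ponens {true} h _ = h

T-all : ∀ {A : Set} (p : A → Bool) xs → (∀ x → T (p x)) → T (all p xs)
T-all p []       h = tt
T-all p (x ∷ xs) h = Equivalence.from T-∧ (h x , T-all p xs h)

every : ∀ n → (Vec Bool n → Bool) → Bool
every zero    f = f []
every (suc n) f = every n (f ∘ (true ∷_)) ∧ every n (f ∘ (false ∷_))

every-sound : ∀ {n} f → T (every n f) → ∀ bs → T (f bs)
every-sound f h []           = h
every-sound f h (true  ∷ bs) = every-sound (f ∘ (true ∷_))  (proj₁ (Equivalence.to T-∧ h)) bs
every-sound f h (false ∷ bs) = every-sound (f ∘ (false ∷_)) (proj₂ (Equivalence.to T-∧ h)) bs

occupancy : (r l d u : Bool) → Direction → Bool
occupancy r l d u right = r
occupancy r l d u left  = l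
occupancy r l d u down  = d
occupancy r l d u up    = u

LocalProperty : Set
LocalProperty = AxisView → AxisView → (Direction → Bool) → Bool

-- Every vertex of P₄ □ Pₘ with m ≥ 4 satisfies these constraints, and the local inequalities
-- fail without them.
admissible : LocalProperty
admissible R C occ =
  rowOK R ∧ axisOK C ∧
  all (λ d → (leaves (rowMove d) R ∨ leaves (colMove d) C) ⇒ not (occ d)) directions

load : AxisView → AxisView → (Direction → Bool) → ℕ
load R C occ = ∑[ d ∈ directions ] ⟦ occ d ⟧ * costᵛ d R C

thresholdOK excessOK : LocalProperty
thresholdOK R C occ = (3 ≤ᵇ (∑[ d ∈ directions ] ⟦ occ d ⟧)) ⇒ (vertexWeightᵛ R C ≤ᵇ load R C occ)
excessOK    R C occ = excessᵛ R C + load R C occ ≤ᵇ 2 * vertexWeightᵛ R C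

checkAt : LocalProperty → Vec Bool 12 → Bool
checkAt P (r₁ ∷ r₂ ∷ r₃ ∷ r₄ ∷ c₁ ∷ c₂ ∷ c₃ ∷ c₄ ∷ o₁ ∷ o₂ ∷ o₃ ∷ o₄ ∷ []) =
  let R = axis r₁ r₂ r₃ r₄ ; C = axis c₁ c₂ c₃ c₄ ; occ = occupancy o₁ o₂ o₃ o₄ in
  admissible R C occ ⇒ P R C occ

holdsLocally : LocalProperty → Bool
holdsLocally P = every 12 (checkAt P)

holdsLocally-sound : ∀ P → T (holdsLocally P) → ∀ R C o₁ o₂ o₃ o₄ →
  let occ = occupancy o₁ o₂ o₃ o₄ in T (admissible R C occ) → T (P R C occ)
holdsLocally-sound P h (axis r₁ r₂ r₃ r₄) (axis c₁ c₂ c₃ c₄) o₁ o₂ o₃ o₄ =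
  modus-ponens (every-sound (checkAt P) h (r₁ ∷ r₂ ∷ r₃ ∷ r₄ ∷ c₁ ∷ c₂ ∷ c₃ ∷ c₄ ∷ o₁ ∷ o₂ ∷ o₃ ∷ o₄ ∷ []))

threshold-holds : T (holdsLocally thresholdOK)
threshold-holds = tt

excess-holds : T (holdsLocally excessOK)
excess-holds = tt

module LocalView {m} (4≤m : 4 ≤ m) (S : Fin 4 × Fin m → Bool) (v : Fin 4 × Fin m) where

  private
    indicator : ∀ d → ∃ λ b → stepSum d v (⟦_⟧ ∘ S) ≡ ⟦ b ⟧
    indicator d = ≤1⇒⟦⟧ (stepSum-≤1 d v S)

  occupied : Direction → Bool
  occupied = occupancy (proj₁ (indicator right)) (proj₁ (indicator left))
                       (proj₁ (indicator down))  (proj₁ (indicator up))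

  stepSum≡occupied : ∀ d → stepSum d v (⟦_⟧ ∘ S) ≡ ⟦ occupied d ⟧
  stepSum≡occupied right = proj₂ (indicator right)
  stepSum≡occupied left  = proj₂ (indicator left)
  stepSum≡occupied down  = proj₂ (indicator down)
  stepSum≡occupied up    = proj₂ (indicator up)

  admissible-occupied : T (admissible (rowView v) (colView v) occupied)
  admissible-occupied = Equivalence.from T-∧
    (rowView-ok (toℕ<n (proj₁ v)) ,
     Equivalence.from T-∧ (axisView-ok 4≤m (toℕ<n (proj₂ v)) , T-all _ directions unblocked))
    where
    unblocked : ∀ d → T (blocked 4 m d (pos v) ⇒ not (occupied d))
    unblocked d with blocked 4 m d (pos v) in eq
    ... | false = tt
    ... | true rewrite ⟦⟧≡0 (trans (sym (stepSum≡occupied d))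
                                    (stepSum-blocked d v (⟦_⟧ ∘ S) (subst T (sym eq) tt))) = tt

  nbrCount≡ : nbrCount (grid 4 m) S v ≡ (∑[ d ∈ directions ] ⟦ occupied d ⟧)
  nbrCount≡ = trans (nbrCount≡∑stepSum S v) (∑-cong directions stepSum≡occupied)

  load≡ : (∑[ u ∈ verts (grid 4 m) ] ⟦ S u ⟧ * edgeCost v u) ≡ load (rowView v) (colView v) occupied
  load≡ = begin
    (∑[ u ∈ verts (grid 4 m) ] ⟦ S u ⟧ * edgeCost v u)
      ≡⟨ ∑-cong (verts (grid 4 m)) (λ u → *-if ⟦ S u ⟧ (adj (grid 4 m) v u) _) ⟩
    (∑[ u ∈ verts (grid 4 m) ]
       (if adj (grid 4 m) v u then ⟦ S u ⟧ * edgeWeight m (pos v) (pos u) else 0))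
      ≡⟨ ∑-adjacent v (λ u → ⟦ S u ⟧ * edgeWeight m (pos v) (pos u)) ⟩
    (∑[ d ∈ directions ] stepSum d v (λ u → ⟦ S u ⟧ * edgeWeight m (pos v) (pos u)))
      ≡⟨ ∑-cong directions (λ d → stepSum-weighted d v (⟦_⟧ ∘ S) (edgeWeight m (pos v))) ⟩
    (∑[ d ∈ directions ] stepSum d v (⟦_⟧ ∘ S) * edgeWeight m (pos v) (neighbour d (pos v)))
      ≡⟨ ∑-cong directions (λ d → cong₂ _*_ (stepSum≡occupied d) (edgeWeight-neighbour d v)) ⟩
    load (rowView v) (colView v) occupied ∎
    where open ≡-Reasoning

  checked : ∀ P → T (holdsLocally P) → T (P (rowView v) (colView v) occupied)
  checked P holds = holdsLocally-sound P holds (rowView v) (colView v)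
    _ _ _ _ admissible-occupied

threshold-local : ∀ {m} → 4 ≤ m → ∀ S (v : Fin 4 × Fin m) → 3 ≤ nbrCount (grid 4 m) S v →
  vertexWeight v ≤ (∑[ u ∈ verts (grid 4 m) ] ⟦ S u ⟧ * edgeCost v u)
threshold-local 4≤m S v three = subst (vertexWeight v ≤_) (sym load≡)
  (≤ᵇ⇒≤ _ _ (modus-ponens (checked thresholdOK threshold-holds)
                          (≤⇒≤ᵇ (subst (3 ≤_) nbrCount≡ three))))
  where open LocalView 4≤m S v

excess-local : ∀ {m} → 4 ≤ m → ∀ (v : Fin 4 × Fin m) →
  excess v + (∑[ u ∈ verts (grid 4 m) ] edgeCost v u) ≤ 2 * vertexWeight v
excess-local {m} 4≤m v =
  subst (λ x → excess v + x ≤ 2 * vertexWeight v)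
        (trans (sym load≡) (∑-cong (verts (grid 4 m)) λ u → *-identityˡ (edgeCost v u)))
        (≤ᵇ⇒≤ _ _ (checked excessOK excess-holds))
  where open LocalView 4≤m (λ _ → true) v

columnExcess : ℕ → ℕ → ℕ
columnExcess m j = ∑[ a ∈ allFin 4 ] excessᵛ (axisView 4 (toℕ a)) (axisView m j)

module _ (k : ℕ) where

  private
    m : ℕ
    m = 4 + k

  columnExcess-middle : ∀ j → j < k → columnExcess m (2 + j) ≡ 10
  columnExcess-middle j j<k
    rewrite dec-false (j ≟ k) (<⇒≢ j<k)
          | dec-false (j ≟ suc k) (<⇒≢ (m<n⇒m<1+n j<k))
          | dec-false (j ≟ suc (suc k)) (<⇒≢ (m<n⇒m<1+n (m<n⇒m<1+n j<k))) = refl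

  columnExcess-second-last : columnExcess m (2 + k) ≡ 8
  columnExcess-second-last
    rewrite dec-true (k ≟ k) refl
          | dec-false (k ≟ suc k) (<⇒≢ (n<1+n k))
          | dec-false (k ≟ suc (suc k)) (<⇒≢ (m<n⇒m<1+n (n<1+n k))) = refl

  columnExcess-last : columnExcess m (3 + k) ≡ 18
  columnExcess-last rewrite dec-true (k ≟ k) refl = refl

  ∑<-columnExcess : ∑< m (columnExcess m) ≡ 10 * m + 12
  ∑<-columnExcess = begin
    18 + (8 + ∑< (2 + k) inner)           ≡⟨ cong (λ x → 18 + (8 + x)) (∑<-snoc (suc k) inner) ⟩
    18 + (8 + (∑< (1 + k) inner + inner (suc k)))
      ≡⟨ cong (λ x → 18 + (8 + (x + inner (suc k)))) (∑<-snoc k inner) ⟩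
    18 + (8 + (∑< k inner + inner k + inner (suc k)))
      ≡⟨ cong₂ (λ x y → 18 + (8 + (x + y + inner (suc k))))
               (trans (∑<-cong k columnExcess-middle) (∑<-const k 10)) columnExcess-second-last ⟩
    18 + (8 + (k * 10 + 8 + inner (suc k)))
      ≡⟨ cong (λ x → 18 + (8 + (k * 10 + 8 + x))) columnExcess-last ⟩
    18 + (8 + (k * 10 + 8 + 18))          ≡⟨ total k ⟩
    10 * m + 12                           ∎
    where
    open ≡-Reasoning
    inner : ℕ → ℕ
    inner j = columnExcess m (2 + j)
    total : ∀ k → 18 + (8 + (k * 10 + 8 + 18)) ≡ 10 * (4 + k) + 12
    total = solve-∀

total-excess : ∀ {m} → 4 ≤ m → (∑[ v ∈ verts (grid 4 m) ] excess v) ≡ 10 * m + 12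
total-excess {m} (s≤s (s≤s (s≤s (s≤s {n = k} _)))) = begin
  (∑[ v ∈ verts (grid 4 m) ] excess v)
    ≡⟨ ∑-cartesianProduct (allFin 4) (allFin m) excess ⟩
  (∑[ a ∈ allFin 4 ] ∑[ b ∈ allFin m ] excess (a , b))
    ≡⟨ ∑-comm (allFin 4) (allFin m) (λ a b → excess (a , b)) ⟩
  (∑[ b ∈ allFin m ] columnExcess m (toℕ b))
    ≡⟨ ∑-allFin m (columnExcess m) ⟩
  ∑< m (columnExcess m)
    ≡⟨ ∑<-columnExcess k ⟩
  10 * m + 12 ∎
  where open ≡-Reasoning

⌊5[m+1]/3⌋+1≤ : ∀ m c → 10 * m + 12 ≤ 6 * c → (5 * (m + 1)) / 3 + 1 ≤ c
⌊5[m+1]/3⌋+1≤ m c bound = subst (_≤ c) (+-comm 1 q) (*-cancelʳ-< 3 q c (begin-strict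
  q * 3           ≤⟨ m/n*n≤m (5 * (m + 1)) 3 ⟩
  5 * (m + 1)     <⟨ ≤-reflexive (one-more m) ⟩
  5 * m + 6       ≤⟨ *-cancelˡ-≤ 2 (subst₂ _≤_ (double m) (*-assoc 2 3 c) bound) ⟩
  3 * c           ≡⟨ *-comm 3 c ⟩
  c * 3           ∎))
  where
  open ≤-Reasoning
  q : ℕ
  q = (5 * (m + 1)) / 3
  one-more : ∀ m → suc (5 * (m + 1)) ≡ 5 * m + 6
  one-more = solve-∀
  double : ∀ m → 10 * m + 12 ≡ 2 * (5 * m + 6)
  double = solve-∀

theorem4 : (m : ℕ) → 4 ≤ m → (A : V (grid 4 m) → Bool) →
    Percolating (grid 4 m) 3 A → (5 * (m + 1)) / 3 + 1 ≤ card (grid 4 m) A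
theorem4 m 4≤m A percolating = ⌊5[m+1]/3⌋+1≤ m (card (grid 4 m) A) (begin
  10 * m + 12                               ≡⟨ total-excess 4≤m ⟨
  (∑[ v ∈ verts (grid 4 m) ] excess v)      ≤⟨ excess-bound excess (excess-local 4≤m) A percolating ⟩
  2 * weight (⟦_⟧ ∘ A)                      ≤⟨ *-monoʳ-≤ 2 (weight≤3*card {m} A) ⟩
  2 * (3 * card (grid 4 m) A)               ≡⟨ *-assoc 2 3 (card (grid 4 m) A) ⟨
  6 * card (grid 4 m) A                     ∎)
  where
  open ≤-Reasoning
  open Potential (grid 4 m) 3 vertexWeight edgeCost edgeCost-comm (threshold-local 4≤m)
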